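{- Let $Q$ be a prime power, let $r$ and $d$ be positive integers, and let $\beta$ be a $(Q+1)$-th root of unity in $\mathbb{F}_{Q^2}$. Then $x^{r+d(Q-1)}+\beta^{ -1} x^r$ permutes $\mathbb{F}_{Q^2}$ if and only if all of the following hold: (1) $\gcd(r,Q-1)=1$; (2) $\gcd(r-d,Q+1)=1$; (3) $(-\beta)^{(Q+1)/\gcd(Q+1,d)}\ne 1$.
   Context: A polynomial $f$ permutes $\mathbb{F}_{Q^2}$ if $\alpha\mapsto f(\alpha)$ is a bijection of $\mathbb{F}_{Q^2}$. -}

module Defs where

open import Level using (Level; _⊔_)
open import Data.Nat using (ℕ; zero; suc; _∸_; _^_; _≤_; NonZero; ≢-nonZero)
open import Data.Nat.GCD using (gcd; gcd[m,n]≢0)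
open import Data.Nat.DivMod using (_/_)
open import Data.Nat.Primality using (Prime)
open import Data.Fin using (Fin)
open import Data.Product using (Σ; ∃; _×_)
open import Data.Sum using (inj₁)
open import Relation.Nullary using (¬_)
open import Relation.Binary.PropositionalEquality as ≡ using (_≡_)
open import Algebra.Bundles using (CommutativeRing; Semiring)
open import Function.Bundles using (Inverse)
open import Function.Definitions using (Bijective)
import Algebra.Definitions.RawSemiring as RS

IsPrimePower : ℕ → Set
IsPrimePower Q = Σ ℕ λ p → Σ ℕ λ k → Prime p × 1 ≤ k × Q ≡ p ^ k

IsField : ∀ {c ℓ} → CommutativeRing c ℓ → Set (c ⊔ ℓ)
IsField R = ¬ (0# ≈ 1#) × (∀ x → ¬ (x ≈ 0#) → ∃ λ y → y * x ≈ 1#)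
  where open CommutativeRing R

HasCard : ∀ {c ℓ} → CommutativeRing c ℓ → ℕ → Set (c ⊔ ℓ)
HasCard R n = Inverse (CommutativeRing.setoid R) (≡.setoid (Fin n))

pow : ∀ {c ℓ} (R : CommutativeRing c ℓ) → CommutativeRing.Carrier R → ℕ → CommutativeRing.Carrier R
pow R = RS._^_ (Semiring.rawSemiring (CommutativeRing.semiring R))

Permutes : ∀ {c ℓ} (R : CommutativeRing c ℓ) → (CommutativeRing.Carrier R → CommutativeRing.Carrier R) → Set (c ⊔ ℓ)
Permutes R f = Bijective _≈_ _≈_ f
  where open CommutativeRing R

-- (Q+1) / gcd(Q+1, d)   (exact division; gcd is nonzero since Q+1 ≠ 0)
expo : ℕ → ℕ → ℕ
expo Q d = _/_ (suc Q) (gcd (suc Q) d) {{≢-nonZero (gcd[m,n]≢0 (suc Q) d (inj₁ λ ()))}}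

{-# OPTIONS --safe #-}
module Submission where

-- Write Q = n + 1, u = xⁿ and H x = uᵈ + β⁻¹, so that f x = xʳ · H x. As u and β are
-- (Q+1)-th roots of unity and x ↦ x^Q is additive, (H x)^Q · uᵈ = β · H x, hence
-- (f x)ⁿ · uᵈ = β · uʳ whenever H x ≠ 0. Condition (3) says that H has no nonzero root;
-- then this identity determines u^|r-d| from f x, condition (2) recovers u from u^|r-d|
-- and u^(Q+1) = 1, and condition (1) recovers x from xⁿ and xʳ. Conversely, if a condition
-- fails, roots of unity of suitable orders (which exist by counting roots of polynomials
-- over the finite field) produce two points with the same image.

open import Defs
open import Level using (_⊔_)
open import Data.Nat as ℕ using (ℕ; zero; suc; _≤_; _<_; _∸_; z≤n; s≤s; ∣_-_∣)
import Data.Nat.Properties as ℕP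
open import Data.Nat.Combinatorics using (_C_; nCn≡1; nC1≡n; nCk+nC[k+1]≡[n+1]C[k+1])
open import Data.Nat.Divisibility using (_∣_; divides; quotient; m∣n⇒n≡quotient*m; m∣n⇒n≡m*quotient; ∣⇒≤; n∣m*n; *-monoˡ-∣)
open import Data.Nat.DivMod using (m/n*n≡m)
open import Data.Nat.Solver using (module +-*-Solver)
open import Data.Nat.GCD using (gcd; gcd[m,n]∣m; gcd[m,n]∣n; gcd-comm; gcd-GCD; gcd[m,n]≢0; module Bézout)
open import Data.Nat.Primality using (Prime; euclidsLemma; prime⇒nonTrivial)
open import Data.Nat.Base using (nonTrivial⇒n>1; nonTrivial⇒nonZero; ≢-nonZero)
open import Data.Fin as Fin using (Fin; toℕ; fromℕ; punchIn; punchOut)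
import Data.Fin.Properties as FinP
open import Data.Fin.Permutation using (Permutation; permutation)
open import Data.Vec as Vec using (Vec; []; _∷_)
open import Data.Vec.Functional using (removeAt)
import Data.Vec.Functional as VecF
open import Data.List using (List; []; _∷_; length; filter; tabulate)
import Data.List.Properties as ListP
open import Data.List.Relation.Unary.All as All using (All; []; _∷_)
import Data.List.Relation.Unary.All.Properties as AllP
open import Data.List.Relation.Unary.Any as Any using (Any; here; there)
open import Data.List.Relation.Unary.AllPairs using (AllPairs; []; _∷_)
import Data.List.Relation.Unary.AllPairs.Properties as AllPairsP
open import Data.List.Membership.Propositional using (_∈_)
import Data.List.Membership.Propositional.Properties as ∈P
open import Data.Product using (∃; _×_; _,_; proj₁; proj₂)
open import Data.Sum using (_⊎_; inj₁; inj₂)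
open import Data.Empty using (⊥; ⊥-elim)
open import Relation.Nullary using (¬_; Dec; yes; no; ¬?; _×-dec_)
open import Relation.Unary using (Decidable)
open import Relation.Binary.PropositionalEquality as ≡ using (_≡_; _≢_)
open import Function using (_∘_)
open import Function.Bundles using (Inverse; _⇔_; mk⇔)
open import Function.Definitions using (Injective; Congruent; Bijective)
open import Algebra.Bundles using (CommutativeRing; CommutativeSemiring)

fin-injective⇒surjective : ∀ {n} (g : Fin n → Fin n) → Injective _≡_ _≡_ g → ∀ t → ∃ λ i → g i ≡ t
fin-injective⇒surjective {suc n} g g-inj t with FinP.any? (λ i → g i FinP.≟ t)
... | yes hit = hit
... | no miss = ⊥-elim (ℕP.1+n≰n (FinP.injective⇒≤ h-inj))
  where
    h : Fin (suc n) → Fin n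
    h i = punchOut {i = t} {j = g i} (λ e → miss (i , ≡.sym e))
    h-inj : Injective _≡_ _≡_ h
    h-inj {i} {j} e = g-inj (FinP.punchOut-injective (λ e → miss (i , ≡.sym e)) (λ e → miss (j , ≡.sym e)) e)

length-filter+length-filter-¬ : ∀ {a p} {A : Set a} {P : A → Set p} (P? : Decidable P) (xs : List A) →
  length xs ≡ length (filter P? xs) ℕ.+ length (filter (¬? ∘ P?) xs)
length-filter+length-filter-¬ P? [] = ≡.refl
length-filter+length-filter-¬ P? (x ∷ xs) with P? x
... | yes _ = ≡.cong suc (length-filter+length-filter-¬ P? xs)
... | no _ = ≡.trans (≡.cong suc (length-filter+length-filter-¬ P? xs)) (≡.sym (ℕP.+-suc _ _))

[1+k]*[1+n]C[1+k]≡[1+n]*nCk : ∀ n k → suc k ℕ.* (suc n C suc k) ≡ suc n ℕ.* (n C k)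
[1+k]*[1+n]C[1+k]≡[1+n]*nCk zero zero = ≡.refl
[1+k]*[1+n]C[1+k]≡[1+n]*nCk zero (suc k) = ℕP.*-zeroʳ (suc (suc k))
[1+k]*[1+n]C[1+k]≡[1+n]*nCk (suc n) zero = ≡.trans (ℕP.*-identityˡ _) (≡.trans (nC1≡n (suc (suc n))) (≡.sym (ℕP.*-identityʳ _)))
[1+k]*[1+n]C[1+k]≡[1+n]*nCk (suc n) (suc k) = begin
    suc (suc k) ℕ.* (suc (suc n) C suc (suc k))     ≡⟨ ≡.cong (suc (suc k) ℕ.*_) (nCk+nC[k+1]≡[n+1]C[k+1] (suc n) (suc k)) ⟨
    suc (suc k) ℕ.* (A ℕ.+ B)                       ≡⟨ ℕP.*-distribˡ-+ (suc (suc k)) A B ⟩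
    suc (suc k) ℕ.* A ℕ.+ suc (suc k) ℕ.* B         ≡⟨ ≡.cong₂ ℕ._+_ (≡.cong (A ℕ.+_) ([1+k]*[1+n]C[1+k]≡[1+n]*nCk n k)) ([1+k]*[1+n]C[1+k]≡[1+n]*nCk n (suc k)) ⟩
    (A ℕ.+ suc n ℕ.* (n C k)) ℕ.+ suc n ℕ.* (n C suc k) ≡⟨ ℕP.+-assoc A _ _ ⟩
    A ℕ.+ (suc n ℕ.* (n C k) ℕ.+ suc n ℕ.* (n C suc k)) ≡⟨ ≡.cong (A ℕ.+_) (≡.sym (ℕP.*-distribˡ-+ (suc n) (n C k) (n C suc k))) ⟩
    A ℕ.+ suc n ℕ.* (n C k ℕ.+ n C suc k)           ≡⟨ ≡.cong (λ z → A ℕ.+ suc n ℕ.* z) (nCk+nC[k+1]≡[n+1]C[k+1] n k) ⟩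
    A ℕ.+ suc n ℕ.* A                               ∎
  where
    open ≡.≡-Reasoning
    A = suc n C suc k
    B = suc n C suc (suc k)

prime∣pCk : ∀ {p} → Prime p → ∀ k → 0 < k → k < p → p ∣ p C k
prime∣pCk {suc n} p-prime (suc j) _ (s≤s j<n)
  with euclidsLemma (suc j) (suc n C suc j) p-prime
         (divides (n C j) (≡.trans ([1+k]*[1+n]C[1+k]≡[1+n]*nCk n j) (ℕP.*-comm (suc n) (n C j))))
... | inj₁ p∣1+j = ⊥-elim (ℕP.<-irrefl ≡.refl (ℕP.≤-trans (s≤s (∣⇒≤ p∣1+j)) (s≤s j<n)))
... | inj₂ p∣pCk = p∣pCk

n≢0∧n≢1⇒2≤n : ∀ {n} → n ≢ 0 → n ≢ 1 → 2 ≤ n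
n≢0∧n≢1⇒2≤n {zero} n≢0 _ = ⊥-elim (n≢0 ≡.refl)
n≢0∧n≢1⇒2≤n {suc zero} _ n≢1 = ⊥-elim (n≢1 ≡.refl)
n≢0∧n≢1⇒2≤n {suc (suc _)} _ _ = s≤s (s≤s z≤n)

no-common-factor⇒gcd≡1 : ∀ a b → a ≢ 0 ⊎ b ≢ 0 → (∀ {l} → l ∣ a → l ∣ b → 2 ≤ l → ⊥) → gcd a b ≡ 1
no-common-factor⇒gcd≡1 a b a≢0⊎b≢0 no-factor with gcd a b ℕ.≟ 1
... | yes gcd≡1 = gcd≡1
... | no gcd≢1 = ⊥-elim (no-factor (gcd[m,n]∣m a b) (gcd[m,n]∣n a b) (n≢0∧n≢1⇒2≤n (gcd[m,n]≢0 a b a≢0⊎b≢0) gcd≢1))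

quotient*k*l≡n*k : ∀ {l n} (l∣n : l ∣ n) k → quotient l∣n ℕ.* k ℕ.* l ≡ n ℕ.* k
quotient*k*l≡n*k {l} (divides q ≡.refl) k = solve 3 (λ q k l → q :* k :* l := q :* l :* k) ≡.refl q k l
  where open +-*-Solver using (solve; _:*_; _:=_)

proper-factor : ∀ m {n o} → m ℕ.* n ≡ o → 1 ≤ o → 2 ≤ n → 1 ≤ m × m < o
proper-factor zero ≡.refl ()
proper-factor (suc m) {n} ≡.refl _ 2≤n = s≤s z≤n , ℕP.m<m*n (suc m) n 2≤n

prime-power≥2 : ∀ {q} → IsPrimePower q → 2 ≤ q
prime-power≥2 (p , suc k , p-prime , _ , ≡.refl) =
  ℕP.≤-trans (nonTrivial⇒n>1 p {{nonTrivial}}) (ℕP.m≤m*n p (p ℕ.^ k) {{ℕP.m^n≢0 p k {{nonTrivial⇒nonZero p {{nonTrivial}}}}}})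
  where nonTrivial = prime⇒nonTrivial p-prime

[1+n]^2≡1+n*[[1+n]+1] : ∀ n → suc n ℕ.^ 2 ≡ suc (n ℕ.* (suc n ℕ.+ 1))
[1+n]^2≡1+n*[[1+n]+1] = solve 1 (λ n → (con 1 :+ n) :^ 2 := con 1 :+ n :* ((con 1 :+ n) :+ con 1)) ≡.refl
  where open +-*-Solver using (solve; _:+_; _:*_; _:^_; _:=_; con)

module FreshmansDream {c ℓ} (R : CommutativeSemiring c ℓ) where

  open CommutativeSemiring R
  open import Relation.Binary.Reasoning.Setoid setoid
  open import Algebra.Properties.Semiring.Exp semiring using (_^_)
  open import Algebra.Properties.Semiring.Sum semiring using (sum; sum-remove; sum-cong-≋; sum-replicate-zero)
  open import Algebra.Properties.Semiring.Mult semiring using () renaming (_×_ to _×′_)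
  open import Algebra.Properties.CommutativeSemiring.Binomial R using (binomialTerm) renaming (theorem to binomial-theorem)

  ^-distrib-+-if-binomials-vanish : ∀ n → 1 < n → (∀ k z → 0 < k → k < n → (n C k) ×′ z ≈ 0#) →
                                    ∀ x y → (x + y) ^ n ≈ x ^ n + y ^ n
  ^-distrib-+-if-binomials-vanish n@(suc (suc m)) (s≤s (s≤s z≤n)) middle≈0 x y = begin
    (x + y) ^ n                                  ≈⟨ binomial-theorem n x y ⟩
    t Fin.zero + sum (t ∘ Fin.suc)               ≈⟨ +-cong first≈ (sum-remove {i = lastᵢ} (t ∘ Fin.suc)) ⟩
    y ^ n + (t (Fin.suc lastᵢ) + sum (removeAt (t ∘ Fin.suc) lastᵢ))
      ≈⟨ +-congˡ (+-cong last≈ (trans (sum-cong-≋ inner≈0) (sum-replicate-zero (suc m)))) ⟩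
    y ^ n + (x ^ n + 0#)                         ≈⟨ +-congˡ (+-identityʳ _) ⟩
    y ^ n + x ^ n                                ≈⟨ +-comm _ _ ⟩
    x ^ n + y ^ n                                ∎
    where
      t = binomialTerm x y n
      lastᵢ : Fin (suc (suc m))
      lastᵢ = fromℕ (suc m)
      first≈ : t Fin.zero ≈ y ^ n
      first≈ = trans (+-identityʳ _) (*-identityˡ _)
      last≈ : t (Fin.suc lastᵢ) ≈ x ^ n
      last≈ = begin
        (n C toℕ (Fin.suc lastᵢ)) ×′ (x ^ toℕ (Fin.suc lastᵢ) * y ^ (n ∸ toℕ (Fin.suc lastᵢ)))
          ≈⟨ reflexive (≡.cong (λ k → (n C k) ×′ (x ^ k * y ^ (n ∸ k))) (≡.cong suc (FinP.toℕ-fromℕ (suc m)))) ⟩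
        (n C n) ×′ (x ^ n * y ^ (n ∸ n))  ≈⟨ reflexive (≡.cong₂ (λ a b → a ×′ (x ^ n * y ^ b)) (nCn≡1 n) (ℕP.n∸n≡0 n)) ⟩
        1 ×′ (x ^ n * 1#)                 ≈⟨ +-identityʳ _ ⟩
        x ^ n * 1#                        ≈⟨ *-identityʳ _ ⟩
        x ^ n                             ∎
      inner≈0 : ∀ j → t (Fin.suc (punchIn lastᵢ j)) ≈ 0#
      inner≈0 j = middle≈0 (suc (toℕ (punchIn lastᵢ j))) _ (s≤s z≤n) (s≤s inner<last)
        where
          inner<last : toℕ (punchIn lastᵢ j) < suc m
          inner<last = ℕP.≤∧≢⇒< (ℕP.≤-pred (FinP.toℕ<n (punchIn lastᵢ j)))
            (λ e → FinP.punchInᵢ≢i lastᵢ j (FinP.toℕ-injective (≡.trans e (≡.sym (FinP.toℕ-fromℕ (suc m))))))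

module FieldProperties {c ℓ} (F : CommutativeRing c ℓ) (isField : IsField F) where

  open CommutativeRing F public
  open import Relation.Binary.Reasoning.Setoid setoid public
  open import Algebra.Properties.Semiring.Exp semiring public using (_^_; ^-congˡ; ^-congʳ; ^-homo-*; ^-assocʳ)
  open import Algebra.Properties.CommutativeSemiring.Exp commutativeSemiring public using (^-distrib-*)
  open import Algebra.Properties.Ring ring public
    using (x∙y⁻¹≈ε⇒x≈y; x≈y⇒x∙y⁻¹≈ε; -‿distribˡ-*; -‿distribʳ-*; x[y-z]≈xy-xz; [y-z]x≈yx-zx; -‿involutive; +-inverseˡ-unique; +-cancelˡ)
  import Algebra.Solver.CommutativeMonoid *-commutativeMonoid as *-Solver
  import Algebra.Solver.CommutativeMonoid +-commutativeMonoid as +-Solver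

  0≉1 : ¬ 0# ≈ 1#
  0≉1 = proj₁ isField

  1≉0 : ¬ 1# ≈ 0#
  1≉0 e = 0≉1 (sym e)

  x≉0∧x*y≈0⇒y≈0 : ∀ {x y} → ¬ x ≈ 0# → x * y ≈ 0# → y ≈ 0#
  x≉0∧x*y≈0⇒y≈0 {x} {y} x≉0 xy≈0 with proj₂ isField x x≉0
  ... | x⁻¹ , x⁻¹x≈1 = begin
    y              ≈⟨ *-identityˡ y ⟨
    1# * y         ≈⟨ *-congʳ x⁻¹x≈1 ⟨
    (x⁻¹ * x) * y  ≈⟨ *-assoc x⁻¹ x y ⟩
    x⁻¹ * (x * y)  ≈⟨ *-congˡ xy≈0 ⟩
    x⁻¹ * 0#       ≈⟨ zeroʳ x⁻¹ ⟩
    0#             ∎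

  x≉0∧y≉0⇒x*y≉0 : ∀ {x y} → ¬ x ≈ 0# → ¬ y ≈ 0# → ¬ x * y ≈ 0#
  x≉0∧y≉0⇒x*y≉0 x≉0 y≉0 xy≈0 = y≉0 (x≉0∧x*y≈0⇒y≈0 x≉0 xy≈0)

  *-cancelʳ-≉0 : ∀ {x y z} → ¬ z ≈ 0# → x * z ≈ y * z → x ≈ y
  *-cancelʳ-≉0 {x} {y} {z} z≉0 xz≈yz = x∙y⁻¹≈ε⇒x≈y x y (x≉0∧x*y≈0⇒y≈0 z≉0 (begin
    z * (x - y)    ≈⟨ x[y-z]≈xy-xz z x y ⟩
    z * x - z * y  ≈⟨ x≈y⇒x∙y⁻¹≈ε (trans (*-comm z x) (trans xz≈yz (*-comm y z))) ⟩
    0#             ∎))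

  *-cancelˡ-≉0 : ∀ {x y z} → ¬ z ≈ 0# → z * x ≈ z * y → x ≈ y
  *-cancelˡ-≉0 {x} {y} {z} z≉0 zx≈zy = *-cancelʳ-≉0 z≉0 (trans (*-comm x z) (trans zx≈zy (*-comm z y)))

  x≉0⇒x^n≉0 : ∀ {x} n → ¬ x ≈ 0# → ¬ x ^ n ≈ 0#
  x≉0⇒x^n≉0 zero x≉0 = 1≉0
  x≉0⇒x^n≉0 (suc n) x≉0 = x≉0∧y≉0⇒x*y≉0 x≉0 (x≉0⇒x^n≉0 n x≉0)

  1^n≈1 : ∀ n → 1# ^ n ≈ 1#
  1^n≈1 zero = refl
  1^n≈1 (suc n) = trans (*-identityˡ _) (1^n≈1 n)

  0^n≈0 : ∀ n → 1 ≤ n → 0# ^ n ≈ 0#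
  0^n≈0 (suc n) _ = zeroˡ _

  x^n≈1⇒x≉0 : ∀ {x} n → 1 ≤ n → x ^ n ≈ 1# → ¬ x ≈ 0#
  x^n≈1⇒x≉0 {x} n 1≤n x^n≈1 x≈0 = 0≉1 (trans (sym (trans (^-congˡ n x≈0) (0^n≈0 n 1≤n))) x^n≈1)

  ^-comm : ∀ x m n → (x ^ m) ^ n ≈ (x ^ n) ^ m
  ^-comm x m n = trans (^-assocʳ x m n) (trans (^-congʳ x (ℕP.*-comm m n)) (sym (^-assocʳ x n m)))

  x^m≈1∧m∣k⇒x^k≈1 : ∀ {x} m {k} → x ^ m ≈ 1# → m ∣ k → x ^ k ≈ 1#
  x^m≈1∧m∣k⇒x^k≈1 {x} m x^m≈1 (divides q ≡.refl) = begin
    x ^ (q ℕ.* m)  ≈⟨ ^-congʳ x (ℕP.*-comm q m) ⟩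
    x ^ (m ℕ.* q)  ≈⟨ ^-assocʳ x m q ⟨
    (x ^ m) ^ q    ≈⟨ ^-congˡ q x^m≈1 ⟩
    1# ^ q         ≈⟨ 1^n≈1 q ⟩
    1#             ∎

  -x*-y≈x*y : ∀ x y → - x * - y ≈ x * y
  -x*-y≈x*y x y = trans (sym (-‿distribˡ-* x (- y))) (trans (-‿cong (sym (-‿distribʳ-* x y))) (-‿involutive _))

  -- In the case g + k m = l n of Bézout's identity, k (n - 1) m ≡ g modulo n.
  ∃[x^m]^k≈x^gcd[m,n] : ∀ {x} m {n} → 1 ≤ n → x ^ n ≈ 1# → ∃ λ k → (x ^ m) ^ k ≈ x ^ gcd m n
  ∃[x^m]^k≈x^gcd[m,n] {x} m {suc n′} _ x^n≈1 with Bézout.identity (gcd-GCD m (suc n′))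
  ... | Bézout.+- k l eq = k , (begin
    (x ^ m) ^ k                  ≈⟨ ^-comm x m k ⟩
    (x ^ k) ^ m                  ≈⟨ ^-assocʳ x k m ⟩
    x ^ (k ℕ.* m)                ≈⟨ ^-congʳ x eq ⟨
    x ^ (g ℕ.+ l ℕ.* suc n′)     ≈⟨ ^-homo-* x g _ ⟩
    x ^ g * x ^ (l ℕ.* suc n′)   ≈⟨ *-congˡ (x^m≈1∧m∣k⇒x^k≈1 (suc n′) x^n≈1 (n∣m*n l)) ⟩
    x ^ g * 1#                   ≈⟨ *-identityʳ _ ⟩
    x ^ g                        ∎)
    where g = gcd m (suc n′)
  ... | Bézout.-+ k l eq = k ℕ.* n′ , *-cancelʳ-≉0 (x≉0⇒x^n≉0 (k ℕ.* m) x≉0) (begin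
    (x ^ m) ^ (k ℕ.* n′) * x ^ (k ℕ.* m)  ≈⟨ *-congʳ (^-assocʳ x m (k ℕ.* n′)) ⟩
    x ^ (m ℕ.* (k ℕ.* n′)) * x ^ (k ℕ.* m) ≈⟨ ^-homo-* x (m ℕ.* (k ℕ.* n′)) (k ℕ.* m) ⟨
    x ^ (m ℕ.* (k ℕ.* n′) ℕ.+ k ℕ.* m)     ≈⟨ ^-congʳ x exponent ⟩
    x ^ ((k ℕ.* m) ℕ.* suc n′)             ≈⟨ x^m≈1∧m∣k⇒x^k≈1 (suc n′) x^n≈1 (n∣m*n (k ℕ.* m)) ⟩
    1#                                     ≈⟨ x^m≈1∧m∣k⇒x^k≈1 (suc n′) x^n≈1 (n∣m*n l) ⟨
    x ^ (l ℕ.* suc n′)                     ≈⟨ ^-congʳ x eq ⟨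
    x ^ (g ℕ.+ k ℕ.* m)                    ≈⟨ ^-homo-* x g (k ℕ.* m) ⟩
    x ^ g * x ^ (k ℕ.* m)                  ∎)
    where
      g = gcd m (suc n′)
      x≉0 : ¬ x ≈ 0#
      x≉0 = x^n≈1⇒x≉0 (suc n′) (s≤s z≤n) x^n≈1
      exponent : m ℕ.* (k ℕ.* n′) ℕ.+ k ℕ.* m ≡ (k ℕ.* m) ℕ.* suc n′
      exponent = solve 3 (λ m k n → m :* (k :* n) :+ k :* m := (k :* m) :* (con 1 :+ n)) ≡.refl m k n′
        where open +-*-Solver using (solve; _:+_; _:*_; _:=_; con)

  coprime-powers⇒≈ : ∀ {x y} m n → 1 ≤ n → gcd m n ≡ 1 → x ^ m ≈ y ^ m → x ^ n ≈ y ^ n → ¬ y ≈ 0# → x ≈ y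
  coprime-powers⇒≈ {x} {y} m n 1≤n gcd≡1 x^m≈y^m x^n≈y^n y≉0 with proj₂ isField y y≉0
  ... | y⁻¹ , y⁻¹y≈1 = *-cancelʳ-≉0 y⁻¹≉0 (trans z≈1 (sym yy⁻¹≈1))
    where
      z = x * y⁻¹
      yy⁻¹≈1 : y * y⁻¹ ≈ 1#
      yy⁻¹≈1 = trans (*-comm y y⁻¹) y⁻¹y≈1
      y⁻¹≉0 : ¬ y⁻¹ ≈ 0#
      y⁻¹≉0 y⁻¹≈0 = 0≉1 (trans (sym (zeroˡ y)) (trans (*-congʳ (sym y⁻¹≈0)) y⁻¹y≈1))
      z^j≈1 : ∀ j → x ^ j ≈ y ^ j → z ^ j ≈ 1#
      z^j≈1 j x^j≈y^j = begin
        (x * y⁻¹) ^ j    ≈⟨ ^-distrib-* x y⁻¹ j ⟩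
        x ^ j * y⁻¹ ^ j  ≈⟨ *-congʳ x^j≈y^j ⟩
        y ^ j * y⁻¹ ^ j  ≈⟨ ^-distrib-* y y⁻¹ j ⟨
        (y * y⁻¹) ^ j    ≈⟨ ^-congˡ j yy⁻¹≈1 ⟩
        1# ^ j           ≈⟨ 1^n≈1 j ⟩
        1#               ∎
      z≈1 : z ≈ 1#
      z≈1 with ∃[x^m]^k≈x^gcd[m,n] {z} m 1≤n (z^j≈1 n x^n≈y^n)
      ... | k , [z^m]^k≈z^gcd = begin
        z            ≈⟨ *-identityʳ z ⟨
        z ^ 1        ≈⟨ ^-congʳ z gcd≡1 ⟨
        z ^ gcd m n  ≈⟨ [z^m]^k≈z^gcd ⟨
        (z ^ m) ^ k  ≈⟨ ^-congˡ k (z^j≈1 m x^m≈y^m) ⟩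
        1# ^ k       ≈⟨ 1^n≈1 k ⟩
        1#           ∎

  Distinct : List Carrier → Set (c ⊔ ℓ)
  Distinct = AllPairs (λ x y → ¬ x ≈ y)

  -- A vector [c₀, …, c_{k-1}] stands for the monic polynomial c₀ + c₁ X + ⋯ + c_{k-1} X^{k-1} + X^k.
  eval : ∀ {k} → Vec Carrier k → Carrier → Carrier
  eval [] x = 1#
  eval (c ∷ cs) x = c + x * eval cs x

  -- Synthetic division: the quotient of c + X P(X) by X - a, where P = eval cs, does not depend on c.
  quotientBy : ∀ {k} → Carrier → Vec Carrier k → Vec Carrier k
  quotientBy a [] = []
  quotientBy a (c ∷ cs) = eval (c ∷ cs) a ∷ quotientBy a cs

  eval-quotientBy : ∀ {k} a c (cs : Vec Carrier k) x → eval (c ∷ cs) x ≈ (x - a) * eval (quotientBy a cs) x + eval (c ∷ cs) a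
  eval-quotientBy a c [] x = begin
    c + x * 1#              ≈⟨ +-congˡ (*-identityʳ x) ⟩
    c + x                   ≈⟨ +-identityʳ _ ⟨
    c + x + 0#              ≈⟨ +-congˡ (-‿inverseˡ a) ⟨
    c + x + (- a + a)       ≈⟨ +-Solver.solve 4 (λ c x -a a → (c ⊕ x) ⊕ (-a ⊕ a) ⊜ (x ⊕ -a) ⊕ (c ⊕ a)) refl c x (- a) a ⟩
    (x - a) + (c + a)       ≈⟨ +-cong (*-identityʳ _) (+-congˡ (*-identityʳ a)) ⟨
    (x - a) * 1# + (c + a * 1#) ∎
    where open +-Solver using (_⊕_; _⊜_)
  eval-quotientBy a c (c′ ∷ cs) x = begin
    c + x * P x                                   ≈⟨ +-congˡ (*-congˡ (eval-quotientBy a c′ cs x)) ⟩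
    c + x * ((x - a) * q + P a)                   ≈⟨ +-congˡ (distribˡ x _ _) ⟩
    c + (x * ((x - a) * q) + x * P a)             ≈⟨ rearrange ⟩
    ((x * P a - a * P a) + x * ((x - a) * q)) + (c + a * P a)
      ≈⟨ +-congʳ (+-cong ([y-z]x≈yx-zx (P a) x a) (*-Solver.solve 3 (λ x y q → y ⊕ (x ⊕ q) ⊜ x ⊕ (y ⊕ q)) refl x (x - a) q)) ⟨
    ((x - a) * P a + (x - a) * (x * q)) + (c + a * P a) ≈⟨ +-congʳ (distribˡ (x - a) (P a) (x * q)) ⟨
    (x - a) * (P a + x * q) + (c + a * P a)       ∎
    where
      P = eval (c′ ∷ cs)
      q = eval (quotientBy a cs) x
      rearrange : c + (x * ((x - a) * q) + x * P a) ≈ ((x * P a - a * P a) + x * ((x - a) * q)) + (c + a * P a)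
      rearrange = begin
        c + (x * ((x - a) * q) + x * P a)                         ≈⟨ +-identityʳ _ ⟨
        c + (x * ((x - a) * q) + x * P a) + 0#                    ≈⟨ +-congˡ (-‿inverseˡ (a * P a)) ⟨
        c + (x * ((x - a) * q) + x * P a) + (- (a * P a) + a * P a)
          ≈⟨ +-Solver.solve 5 (λ c u v -w w → (c ⊕ (u ⊕ v)) ⊕ (-w ⊕ w) ⊜ ((v ⊕ -w) ⊕ u) ⊕ (c ⊕ w)) refl c _ _ (- (a * P a)) (a * P a) ⟩
        ((x * P a - a * P a) + x * ((x - a) * q)) + (c + a * P a) ∎
        where open +-Solver using (_⊕_; _⊜_)
      open *-Solver using (_⊕_; _⊜_)

  eval-quotientBy-root : ∀ {k a y} c (cs : Vec Carrier k) → eval (c ∷ cs) a ≈ 0# → ¬ a ≈ y → eval (c ∷ cs) y ≈ 0# → eval (quotientBy a cs) y ≈ 0#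
  eval-quotientBy-root {a = a} {y} c cs pa≈0 a≉y py≈0 = x≉0∧x*y≈0⇒y≈0 y-a≉0 (begin
    (y - a) * eval (quotientBy a cs) y                       ≈⟨ +-identityʳ _ ⟨
    (y - a) * eval (quotientBy a cs) y + 0#                  ≈⟨ +-congˡ pa≈0 ⟨
    (y - a) * eval (quotientBy a cs) y + eval (c ∷ cs) a     ≈⟨ eval-quotientBy a c cs y ⟨
    eval (c ∷ cs) y                                        ≈⟨ py≈0 ⟩
    0#                                                     ∎)
    where
      y-a≉0 : ¬ y - a ≈ 0#
      y-a≉0 y-a≈0 = a≉y (sym (x∙y⁻¹≈ε⇒x≈y y a y-a≈0))

  length-roots≤degree : ∀ {k} (p : Vec Carrier k) {L} → Distinct L → All (λ x → eval p x ≈ 0#) L → length L ≤ k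
  length-roots≤degree p {[]} _ _ = z≤n
  length-roots≤degree [] {a ∷ L} _ (pa≈0 ∷ _) = ⊥-elim (1≉0 pa≈0)
  length-roots≤degree (c ∷ cs) {a ∷ L} (a∉L ∷ L-distinct) (pa≈0 ∷ pL≈0) =
    s≤s (length-roots≤degree (quotientBy a cs) L-distinct
          (All.zipWith (λ (a≉y , py≈0) → eval-quotientBy-root c cs pa≈0 a≉y py≈0) (a∉L , pL≈0)))

  eval-replicate-0 : ∀ m x → eval (Vec.replicate m 0#) x ≈ x ^ m
  eval-replicate-0 zero x = refl
  eval-replicate-0 (suc m) x = trans (+-identityˡ _) (*-congˡ (eval-replicate-0 m x))

  x^[1+m]≈y⇒root : ∀ m {x y} → x ^ suc m ≈ y → eval (- y ∷ Vec.replicate m 0#) x ≈ 0#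
  x^[1+m]≈y⇒root m {x} {y} x^[1+m]≈y = trans (+-congˡ (trans (*-congˡ (eval-replicate-0 m x)) x^[1+m]≈y)) (-‿inverseˡ y)

  length-solutions-x^[1+m]≈y≤1+m : ∀ m y {L} → Distinct L → All (λ x → x ^ suc m ≈ y) L → length L ≤ suc m
  length-solutions-x^[1+m]≈y≤1+m m y L-distinct solutions =
    length-roots≤degree (- y ∷ Vec.replicate m 0#) L-distinct (All.map (x^[1+m]≈y⇒root m) solutions)

module FiniteFieldProperties {c ℓ} (F : CommutativeRing c ℓ) (isField : IsField F) (N : ℕ) (card : HasCard F (suc N)) where

  open FieldProperties F isField public
  open Inverse card using (to; from; to-cong; inverseˡ; inverseʳ)
  open import Algebra.Properties.CommutativeMonoid.Sum *-commutativeMonoid as Product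
    using () renaming (sum to ∏)
  open import Algebra.Properties.Semiring.Sum semiring as Sum using (sum)
  open import Algebra.Properties.Semiring.Mult semiring using (×-assoc-*; ×1-homo-*; ×-assocˡ; ×-congʳ) renaming (_×_ to _×′_)
  open FreshmansDream commutativeSemiring using (^-distrib-+-if-binomials-vanish)

  from-to : ∀ x → from (to x) ≈ x
  from-to x = inverseʳ ≡.refl

  to-from : ∀ i → to (from i) ≡ i
  to-from i = inverseˡ refl

  to-injective : ∀ {x y} → to x ≡ to y → x ≈ y
  to-injective {x} {y} e = trans (sym (from-to x)) (trans (reflexive (≡.cong from e)) (from-to y))

  from-injective : ∀ {i j} → from i ≈ from j → i ≡ j
  from-injective {i} {j} e = ≡.trans (≡.sym (to-from i)) (≡.trans (to-cong e) (to-from j))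

  infix 4 _≈?_
  _≈?_ : ∀ x y → Dec (x ≈ y)
  x ≈? y with to x FinP.≟ to y
  ... | yes e = yes (to-injective e)
  ... | no ne = no (λ e → ne (to-cong e))

  x^n≈0⇒x≈0 : ∀ {x} n → x ^ n ≈ 0# → x ≈ 0#
  x^n≈0⇒x≈0 {x} n x^n≈0 with x ≈? 0#
  ... | yes x≈0 = x≈0
  ... | no x≉0 = ⊥-elim (x≉0⇒x^n≉0 n x≉0 x^n≈0)

  injective⇒bijective : ∀ {f} → Congruent _≈_ _≈_ f → Injective _≈_ _≈_ f → Bijective _≈_ _≈_ f
  injective⇒bijective {f} f-cong f-inj = f-inj , surjective
    where
      surjective : ∀ y → ∃ λ x → ∀ {z} → z ≈ x → f z ≈ y
      surjective y =
        let i , e = fin-injective⇒surjective (λ i → to (f (from i))) (λ e → from-injective (f-inj (to-injective e))) (to y)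
        in from i , λ z≈x → trans (f-cong z≈x) (to-injective e)

  permutationOf : (g h : Carrier → Carrier) → Congruent _≈_ _≈_ g → Congruent _≈_ _≈_ h →
                  (∀ x → g (h x) ≈ x) → (∀ x → h (g x) ≈ x) → Permutation (suc N) (suc N)
  permutationOf g h g-cong h-cong g∘h≈id h∘g≈id =
    permutation (λ i → to (g (from i))) (λ i → to (h (from i))) (back g h g-cong g∘h≈id) (back h g h-cong h∘g≈id)
    where
      back : ∀ g h → Congruent _≈_ _≈_ g → (∀ x → g (h x) ≈ x) → ∀ i → to (g (from (to (h (from i))))) ≡ i
      back g h g-cong g∘h≈id i = ≡.trans (to-cong (trans (g-cong (from-to _)) (g∘h≈id (from i)))) (to-from i)

  -- x ↦ a x permutes F, so ∏ ⌊ x ⌋ = ∏ ⌊ a x ⌋ = a^N ∏ ⌊ x ⌋, where ⌊ x ⌋ replaces 0 by 1.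
  fermat : ∀ {a} → ¬ a ≈ 0# → a ^ N ≈ 1#
  fermat {a} a≉0 with proj₂ isField a a≉0
  ... | a⁻¹ , a⁻¹a≈1 = sym (*-cancelʳ-≉0 (∏-nonzero (λ i → ⌊ from i ⌋-nonzero)) (begin
    1# * ∏ G                    ≈⟨ *-identityˡ _ ⟩
    ∏ G                         ≈⟨ Product.sum-permute G scaling ⟩
    ∏ (λ i → G (to (a * from i))) ≈⟨ Product.sum-cong-≋ (λ i → trans (⌊⌋-cong (from-to _)) (⌊a*x⌋ (from i))) ⟩
    ∏ (λ i → A (from i) * G i)  ≈⟨ Product.∑-distrib-+ (λ i → A (from i)) G ⟩
    ∏ (λ i → A (from i)) * ∏ G  ≈⟨ *-congʳ ∏A≈a^N ⟩
    a ^ N * ∏ G                 ∎))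
    where
      ⌊_⌋ : Carrier → Carrier
      ⌊ x ⌋ with x ≈? 0#
      ... | yes _ = 1#
      ... | no _ = x

      ⌊_⌋-nonzero : ∀ x → ¬ ⌊ x ⌋ ≈ 0#
      ⌊ x ⌋-nonzero with x ≈? 0#
      ... | yes _ = 1≉0
      ... | no x≉0 = x≉0

      ⌊⌋-cong : Congruent _≈_ _≈_ ⌊_⌋
      ⌊⌋-cong {x} {y} x≈y with x ≈? 0# | y ≈? 0#
      ... | yes _ | yes _ = refl
      ... | yes x≈0 | no y≉0 = ⊥-elim (y≉0 (trans (sym x≈y) x≈0))
      ... | no x≉0 | yes y≈0 = ⊥-elim (x≉0 (trans x≈y y≈0))
      ... | no _ | no _ = x≈y

      A : Carrier → Carrier
      A x with x ≈? 0#
      ... | yes _ = 1#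
      ... | no _ = a

      ⌊a*x⌋ : ∀ x → ⌊ a * x ⌋ ≈ A x * ⌊ x ⌋
      ⌊a*x⌋ x with x ≈? 0# | a * x ≈? 0#
      ... | yes _ | yes _ = sym (*-identityˡ _)
      ... | yes x≈0 | no ax≉0 = ⊥-elim (ax≉0 (trans (*-congˡ x≈0) (zeroʳ a)))
      ... | no x≉0 | yes ax≈0 = ⊥-elim (x≉0∧y≉0⇒x*y≉0 a≉0 x≉0 ax≈0)
      ... | no _ | no _ = refl

      G : Fin (suc N) → Carrier
      G i = ⌊ from i ⌋

      ∏-nonzero : ∀ {n} {v : Fin n → Carrier} → (∀ i → ¬ v i ≈ 0#) → ¬ ∏ v ≈ 0#
      ∏-nonzero {zero} _ = 1≉0
      ∏-nonzero {suc n} v≉0 = x≉0∧y≉0⇒x*y≉0 (v≉0 Fin.zero) (∏-nonzero (v≉0 ∘ Fin.suc))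

      scaling : Permutation (suc N) (suc N)
      scaling = permutationOf (a *_) (a⁻¹ *_) *-congˡ *-congˡ
        (λ x → trans (sym (*-assoc a a⁻¹ x)) (trans (*-congʳ (trans (*-comm a a⁻¹) a⁻¹a≈1)) (*-identityˡ x)))
        (λ x → trans (sym (*-assoc a⁻¹ a x)) (trans (*-congʳ a⁻¹a≈1) (*-identityˡ x)))

      ∏A≈a^N : ∏ (λ i → A (from i)) ≈ a ^ N
      ∏A≈a^N = begin
        ∏ (λ i → A (from i))                                   ≈⟨ Product.sum-remove {i = to 0#} (λ i → A (from i)) ⟩
        A (from (to 0#)) * ∏ (removeAt (λ i → A (from i)) (to 0#)) ≈⟨ *-cong A0≈1 (Product.sum-cong-≋ others≈a) ⟩
        1# * ∏ (VecF.replicate N a)                            ≈⟨ *-identityˡ _ ⟩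
        ∏ (VecF.replicate N a)                                 ≈⟨ Product.sum-replicate N ⟩
        a ^ N                                                  ∎
        where
          A0≈1 : A (from (to 0#)) ≈ 1#
          A0≈1 with from (to 0#) ≈? 0#
          ... | yes _ = refl
          ... | no ≉0 = ⊥-elim (≉0 (from-to 0#))
          others≈a : ∀ j → A (from (punchIn (to 0#) j)) ≈ a
          others≈a j with from (punchIn (to 0#) j) ≈? 0#
          ... | yes ≈0 = ⊥-elim (FinP.punchInᵢ≢i (to 0#) j (≡.trans (≡.sym (to-from _)) (to-cong ≈0)))
          ... | no _ = refl

  elements : List Carrier
  elements = tabulate from

  elements-distinct : Distinct elements
  elements-distinct = AllPairsP.tabulate⁺ (λ i≢j e → i≢j (from-injective e))

  length-elements : length elements ≡ suc N
  length-elements = ListP.length-tabulate from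

  from-to∈elements : ∀ x → from (to x) ∈ elements
  from-to∈elements x = ∈P.∈-tabulate⁺ {f = from} (to x)

  all-elements : ∀ {p} {P : Carrier → Set p} → (∀ x → P x) → All P elements
  all-elements P-holds = AllP.tabulate⁺ (λ i → P-holds (from i))

  length≤length*fibre : (φ : Carrier → Carrier) (D : ℕ) →
    (∀ y {M} → Distinct M → All (λ x → φ x ≈ y) M → length M ≤ D) →
    ∀ V {L} → Distinct L → All (λ x → Any (φ x ≈_) V) L → length L ≤ length V ℕ.* D
  length≤length*fibre φ D fibre≤D [] {[]} _ _ = z≤n
  length≤length*fibre φ D fibre≤D [] {x ∷ L} _ (() ∷ _)
  length≤length*fibre φ D fibre≤D (v ∷ V) {L} L-distinct L↦V =
    ℕP.≤-trans (ℕP.≤-reflexive (length-filter+length-filter-¬ φx≈v? L)) (ℕP.+-mono-≤ over-v over-V)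
    where
      φx≈v? : Decidable (λ x → φ x ≈ v)
      φx≈v? x = φ x ≈? v
      over-v : length (filter φx≈v? L) ≤ D
      over-v = fibre≤D v (AllPairsP.filter⁺ φx≈v? L-distinct) (AllP.all-filter φx≈v? L)
      rest : ∀ L → All (λ x → Any (φ x ≈_) (v ∷ V)) L → All (λ x → Any (φ x ≈_) V) (filter (¬? ∘ φx≈v?) L)
      rest [] [] = []
      rest (x ∷ L) (x↦ ∷ L↦) with φx≈v? x
      ... | yes _ = rest L L↦
      ... | no φx≉v with x↦
      ...   | here φx≈v = ⊥-elim (φx≉v φx≈v)
      ...   | there x↦V = x↦V ∷ rest L L↦
      over-V : length (filter (¬? ∘ φx≈v?) L) ≤ length V ℕ.* D
      over-V = length≤length*fibre φ D fibre≤D V (AllPairsP.filter⁺ (¬? ∘ φx≈v?) L-distinct) (rest L L↦V)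

  -- x ↦ x^D maps into 0 and the E-th roots of unity with fibres of size at most D; if c were missed,
  -- the E-th roots of unity other than c would be too few to cover all of F.
  ∃x^D≈c : ∀ D E → 1 ≤ D → 1 ≤ E → D ℕ.* E ≡ N → ∀ {c} → c ^ E ≈ 1# → ∃ λ w → w ^ D ≈ c
  ∃x^D≈c (suc D′) (suc E′) _ _ DE≡N {c} c^E≈1 with FinP.any? (λ i → from i ^ suc D′ ≈? c)
  ... | yes (i , e) = from i , e
  ... | no missed = ⊥-elim (ℕP.1+n≰n (ℕP.≤-trans all≤others*D (ℕP.≤-trans (ℕP.*-monoˡ-≤ D others<E) E*D≤N)))
    where
      D = suc D′
      E = suc E′
      other-root? : Decidable (λ y → (y ^ E ≈ 1#) × ¬ (y ≈ c))
      other-root? y = (y ^ E ≈? 1#) ×-dec ¬? (y ≈? c)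
      others = filter other-root? elements
      V = 0# ∷ others
      fibre≤D : ∀ y {M} → Distinct M → All (λ x → x ^ D ≈ y) M → length M ≤ D
      fibre≤D y = length-solutions-x^[1+m]≈y≤1+m D′ y
      covered : ∀ x → Any (x ^ D ≈_) V
      covered x with x ≈? 0#
      ... | yes x≈0 = here (trans (^-congˡ D x≈0) (0^n≈0 D (s≤s z≤n)))
      ... | no x≉0 = there (Any.map (λ eq → trans (sym (from-to _)) (reflexive eq)) x^D∈others)
        where
          y = from (to (x ^ D))
          y^E≈1 : y ^ E ≈ 1#
          y^E≈1 = begin
            y ^ E            ≈⟨ ^-congˡ E (from-to _) ⟩
            (x ^ D) ^ E      ≈⟨ ^-assocʳ x D E ⟩
            x ^ (D ℕ.* E)    ≈⟨ ^-congʳ x DE≡N ⟩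
            x ^ N            ≈⟨ fermat x≉0 ⟩
            1#               ∎
          x^D∈others : y ∈ others
          x^D∈others = ∈P.∈-filter⁺ other-root? (from-to∈elements (x ^ D))
            (y^E≈1 , λ y≈c → missed (to x , trans (^-congˡ D (from-to x)) (trans (sym (from-to _)) y≈c)))
      all≤others*D : suc N ≤ suc (length others) ℕ.* D
      all≤others*D = ≡.subst (_≤ suc (length others) ℕ.* D) length-elements
        (length≤length*fibre (_^ D) D fibre≤D V elements-distinct (all-elements covered))
      E*D≤N : E ℕ.* D ≤ N
      E*D≤N = ℕP.≤-reflexive (≡.trans (ℕP.*-comm E D) DE≡N)
      others<E : suc (length others) ≤ E
      others<E = length-solutions-x^[1+m]≈y≤1+m E′ 1# {c ∷ others}
        (All.map (λ p c≈ → proj₂ p (sym c≈)) (AllP.all-filter other-root? elements) ∷ AllPairsP.filter⁺ other-root? elements-distinct)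
        (c^E≈1 ∷ All.map proj₁ (AllP.all-filter other-root? elements))

  -- Otherwise every element would be a root of X (X^D - 1), a polynomial of degree D + 1 < |F|.
  ∃x^D≉1 : ∀ D → 1 ≤ D → D < N → ∃ λ x → ¬ x ≈ 0# × ¬ x ^ D ≈ 1#
  ∃x^D≉1 (suc m) _ D<N with FinP.any? (λ i → ¬? (from i ≈? 0#) ×-dec ¬? (from i ^ suc m ≈? 1#))
  ... | yes (i , found) = from i , found
  ... | no none = ⊥-elim (ℕP.<-irrefl ≡.refl (ℕP.<-≤-trans D<N (ℕP.≤-pred all≤D+1)))
    where
      root : ∀ x → eval (0# ∷ - 1# ∷ Vec.replicate m 0#) x ≈ 0#
      root x with x ≈? 0#
      ... | yes x≈0 = trans (+-identityˡ _) (trans (*-congʳ x≈0) (zeroˡ _))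
      ... | no x≉0 with x ^ suc m ≈? 1#
      ...   | yes x^D≈1 = trans (+-identityˡ _) (trans (*-congˡ (x^[1+m]≈y⇒root m x^D≈1)) (zeroʳ _))
      ...   | no x^D≉1 = ⊥-elim (none (to x , (λ ≈0 → x≉0 (trans (sym (from-to x)) ≈0))
                                            , (λ ≈1 → x^D≉1 (trans (^-congˡ (suc m) (sym (from-to x))) ≈1))))
      all≤D+1 : suc N ≤ suc (suc m)
      all≤D+1 = ≡.subst (_≤ suc (suc m)) length-elements
        (length-roots≤degree (0# ∷ - 1# ∷ Vec.replicate m 0#) elements-distinct (all-elements root))

  1≤N : 1 ≤ N
  1≤N = ℕP.≤-pred (FinP.injective⇒≤ ι-injective)
    where
      ι : Fin 2 → Fin (suc N)
      ι Fin.zero = to 0#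
      ι (Fin.suc _) = to 1#
      ι-injective : Injective _≡_ _≡_ ι
      ι-injective {Fin.zero} {Fin.zero} _ = ≡.refl
      ι-injective {Fin.zero} {Fin.suc Fin.zero} e = ⊥-elim (0≉1 (to-injective e))
      ι-injective {Fin.suc Fin.zero} {Fin.zero} e = ⊥-elim (1≉0 (to-injective e))
      ι-injective {Fin.suc Fin.zero} {Fin.suc Fin.zero} _ = ≡.refl

  ∃ω^g≈1∧ω^e≉1 : ∀ D {g e} → D ℕ.* g ≡ N → 1 ≤ e → e < g → ∃ λ ω → ω ^ g ≈ 1# × ¬ ω ^ e ≈ 1#
  ∃ω^g≈1∧ω^e≉1 D {g} {e} D*g≡N 1≤e e<g =
    let x , x≉0 , x^De≉1 = ∃x^D≉1 (D ℕ.* e) (ℕP.*-mono-≤ 1≤D 1≤e) De<N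
    in x ^ D , trans (^-assocʳ x D g) (trans (^-congʳ x D*g≡N) (fermat x≉0)) , λ ω^e≈1 → x^De≉1 (trans (sym (^-assocʳ x D e)) ω^e≈1)
    where
      1≤D : 1 ≤ D
      1≤D = proj₁ (proper-factor D D*g≡N 1≤N (ℕP.≤-trans (s≤s 1≤e) e<g))
      De<N : D ℕ.* e < N
      De<N = ℕP.<-≤-trans (ℕP.*-monoʳ-< D {{ℕ.>-nonZero 1≤D}} e<g) (ℕP.≤-reflexive D*g≡N)

  -- Translation by x permutes F, so ∑ y = ∑ (y + x) = ∑ y + |F| x.
  [1+N]×x≈0 : ∀ x → suc N ×′ x ≈ 0#
  [1+N]×x≈0 x = sym (+-cancelˡ (sum from) _ _ (begin
    sum from + 0#                             ≈⟨ +-identityʳ _ ⟩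
    sum from                                  ≈⟨ Sum.sum-permute from translation ⟩
    sum (λ i → from (to (from i + x)))        ≈⟨ Sum.sum-cong-≋ (λ i → from-to (from i + x)) ⟩
    sum (λ i → from i + x)                    ≈⟨ Sum.∑-distrib-+ from (λ _ → x) ⟩
    sum from + sum (VecF.replicate (suc N) x) ≈⟨ +-congˡ (Sum.sum-replicate (suc N)) ⟩
    sum from + suc N ×′ x                     ∎))
    where
      translation : Permutation (suc N) (suc N)
      translation = permutationOf (_+ x) (_- x) +-congʳ +-congʳ
        (λ y → trans (+-assoc y (- x) x) (trans (+-congˡ (-‿inverseˡ x)) (+-identityʳ y)))
        (λ y → trans (+-assoc y x (- x)) (trans (+-congˡ (-‿inverseʳ x)) (+-identityʳ y)))

  module _ {p} (p-prime : Prime p) {j} (card≡p^j : suc N ≡ p ℕ.^ j) where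

    p×1≈0 : p ×′ 1# ≈ 0#
    p×1≈0 = x^n≈0⇒x≈0 j (begin
      (p ×′ 1#) ^ j    ≈⟨ p×1^i≈p^i×1 j ⟩
      (p ℕ.^ j) ×′ 1#  ≈⟨ reflexive (≡.cong (_×′ 1#) card≡p^j) ⟨
      suc N ×′ 1#      ≈⟨ [1+N]×x≈0 1# ⟩
      0#               ∎)
      where
        p×1^i≈p^i×1 : ∀ i → (p ×′ 1#) ^ i ≈ (p ℕ.^ i) ×′ 1#
        p×1^i≈p^i×1 zero = sym (+-identityʳ _)
        p×1^i≈p^i×1 (suc i) = trans (*-congˡ (p×1^i≈p^i×1 i)) (sym (×1-homo-* p (p ℕ.^ i)))

    pCk×x≈0 : ∀ k x → 0 < k → k < p → (p C k) ×′ x ≈ 0#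
    pCk×x≈0 k x 0<k k<p with prime∣pCk p-prime k 0<k k<p
    ... | divides q pCk≡q*p = begin
      (p C k) ×′ x         ≈⟨ reflexive (≡.cong (_×′ x) pCk≡q*p) ⟩
      (q ℕ.* p) ×′ x       ≈⟨ ×-assocˡ x q p ⟨
      q ×′ (p ×′ x)        ≈⟨ ×-congʳ q p×x≈0 ⟩
      q ×′ 0#              ≈⟨ n×0≈0 q ⟩
      0#                   ∎
      where
        p×x≈0 : p ×′ x ≈ 0#
        p×x≈0 = begin
          p ×′ x           ≈⟨ ×-congʳ p (*-identityˡ x) ⟨
          p ×′ (1# * x)    ≈⟨ ×-assoc-* p 1# x ⟨
          (p ×′ 1#) * x    ≈⟨ *-congʳ p×1≈0 ⟩
          0# * x           ≈⟨ zeroˡ x ⟩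
          0#               ∎
        n×0≈0 : ∀ n → n ×′ 0# ≈ 0#
        n×0≈0 zero = refl
        n×0≈0 (suc n) = trans (+-identityˡ _) (n×0≈0 n)

    frobenius : ∀ i x y → (x + y) ^ (p ℕ.^ i) ≈ x ^ (p ℕ.^ i) + y ^ (p ℕ.^ i)
    frobenius zero x y = trans (*-identityʳ _) (+-cong (sym (*-identityʳ x)) (sym (*-identityʳ y)))
    frobenius (suc i) x y = begin
      (x + y) ^ (p ℕ.* p ℕ.^ i)               ≈⟨ ^-assocʳ (x + y) p (p ℕ.^ i) ⟨
      ((x + y) ^ p) ^ (p ℕ.^ i)               ≈⟨ ^-congˡ (p ℕ.^ i) frobenius-p ⟩
      (x ^ p + y ^ p) ^ (p ℕ.^ i)             ≈⟨ frobenius i (x ^ p) (y ^ p) ⟩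
      (x ^ p) ^ (p ℕ.^ i) + (y ^ p) ^ (p ℕ.^ i) ≈⟨ +-cong (^-assocʳ x p _) (^-assocʳ y p _) ⟩
      x ^ (p ℕ.* p ℕ.^ i) + y ^ (p ℕ.* p ℕ.^ i) ∎
      where
        frobenius-p : (x + y) ^ p ≈ x ^ p + y ^ p
        frobenius-p = ^-distrib-+-if-binomials-vanish p (nonTrivial⇒n>1 p {{prime⇒nonTrivial p-prime}}) pCk×x≈0 x y

-- Q = n + 1 throughout, and |F| = Q² is written 1 + n (Q + 1).
module PermutationCriterion {c ℓ} (F : CommutativeRing c ℓ) (isField : IsField F) (n : ℕ)
                            (card : HasCard F (suc (n ℕ.* (suc n ℕ.+ 1)))) where

  open FiniteFieldProperties F isField (n ℕ.* (suc n ℕ.+ 1)) card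
  import Algebra.Solver.CommutativeMonoid *-commutativeMonoid as *-Solver

  x^Q-additive⇐Q≡p^k : ∀ {p k} → Prime p → suc n ≡ p ℕ.^ k → ∀ x y → (x + y) ^ suc n ≈ x ^ suc n + y ^ suc n
  x^Q-additive⇐Q≡p^k {p} {k} p-prime Q≡p^k x y = begin
    (x + y) ^ suc n                ≈⟨ ^-congʳ (x + y) Q≡p^k ⟩
    (x + y) ^ (p ℕ.^ k)            ≈⟨ frobenius p-prime {k ℕ.* 2} card≡p^[k*2] k x y ⟩
    x ^ (p ℕ.^ k) + y ^ (p ℕ.^ k)  ≈⟨ +-cong (^-congʳ x Q≡p^k) (^-congʳ y Q≡p^k) ⟨
    x ^ suc n + y ^ suc n          ∎
    where
      card≡p^[k*2] : suc (n ℕ.* (suc n ℕ.+ 1)) ≡ p ℕ.^ (k ℕ.* 2)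
      card≡p^[k*2] = ≡.trans (≡.sym ([1+n]^2≡1+n*[[1+n]+1] n)) (≡.trans (≡.cong (ℕ._^ 2) Q≡p^k) (ℕP.^-*-assoc p k 2))

  module _ (1≤n : 1 ≤ n) (x^Q-additive : ∀ x y → (x + y) ^ suc n ≈ x ^ suc n + y ^ suc n)
           (r d : ℕ) (1≤r : 1 ≤ r) (1≤d : 1 ≤ d) (β β⁻¹ : Carrier)
           (β^[Q+1]≈1 : β ^ (suc n ℕ.+ 1) ≈ 1#) (β⁻¹β≈1 : β⁻¹ * β ≈ 1#) where

    Q+1 : ℕ
    Q+1 = suc n ℕ.+ 1

    Q+1≡2+n : Q+1 ≡ suc (suc n)
    Q+1≡2+n = ℕP.+-comm (suc n) 1

    f : Carrier → Carrier
    f x = x ^ (r ℕ.+ d ℕ.* n) + β⁻¹ * x ^ r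

    H : Carrier → Carrier
    H x = (x ^ n) ^ d + β⁻¹

    f≈x^r*H : ∀ x → f x ≈ x ^ r * H x
    f≈x^r*H x = begin
      x ^ (r ℕ.+ d ℕ.* n) + β⁻¹ * x ^ r    ≈⟨ +-cong (^-homo-* x r (d ℕ.* n)) (*-comm _ _) ⟩
      x ^ r * x ^ (d ℕ.* n) + x ^ r * β⁻¹  ≈⟨ +-congʳ (*-congˡ (trans (^-congʳ x (ℕP.*-comm d n)) (sym (^-assocʳ x n d)))) ⟩
      x ^ r * (x ^ n) ^ d + x ^ r * β⁻¹    ≈⟨ distribˡ _ _ _ ⟨
      x ^ r * H x                          ∎

    f-cong : Congruent _≈_ _≈_ f
    f-cong x≈y = +-cong (^-congˡ (r ℕ.+ d ℕ.* n) x≈y) (*-congˡ (^-congˡ r x≈y))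

    f0≈0 : f 0# ≈ 0#
    f0≈0 = trans (f≈x^r*H 0#) (trans (*-congʳ (0^n≈0 r 1≤r)) (zeroˡ _))

    f≉0 : ∀ {x} → ¬ x ≈ 0# → ¬ H x ≈ 0# → ¬ f x ≈ 0#
    f≉0 x≉0 Hx≉0 fx≈0 = x≉0∧y≉0⇒x*y≉0 (x≉0⇒x^n≉0 r x≉0) Hx≉0 (trans (sym (f≈x^r*H _)) fx≈0)

    β≉0 : ¬ β ≈ 0#
    β≉0 β≈0 = 0≉1 (trans (sym (zeroʳ β⁻¹)) (trans (*-congˡ (sym β≈0)) β⁻¹β≈1))

    β⁻¹≉0 : ¬ β⁻¹ ≈ 0#
    β⁻¹≉0 β⁻¹≈0 = 0≉1 (trans (sym (zeroˡ β)) (trans (*-congʳ (sym β⁻¹≈0)) β⁻¹β≈1))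

    [x^n]^[Q+1]≈1 : ∀ {x} → ¬ x ≈ 0# → (x ^ n) ^ Q+1 ≈ 1#
    [x^n]^[Q+1]≈1 {x} x≉0 = trans (^-assocʳ x n Q+1) (fermat x≉0)

    x^[Q+1]≈x*x^Q : ∀ x → x ^ Q+1 ≈ x * x ^ suc n
    x^[Q+1]≈x*x^Q x = ^-congʳ x Q+1≡2+n

    β⁻¹^[Q+1]≈1 : β⁻¹ ^ Q+1 ≈ 1#
    β⁻¹^[Q+1]≈1 = *-cancelʳ-≉0 (x≉0⇒x^n≉0 Q+1 β≉0) (begin
      β⁻¹ ^ Q+1 * β ^ Q+1  ≈⟨ ^-distrib-* β⁻¹ β Q+1 ⟨
      (β⁻¹ * β) ^ Q+1      ≈⟨ ^-congˡ Q+1 β⁻¹β≈1 ⟩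
      1# ^ Q+1             ≈⟨ 1^n≈1 Q+1 ⟩
      1#                   ≈⟨ β^[Q+1]≈1 ⟨
      β ^ Q+1              ≈⟨ *-identityˡ _ ⟨
      1# * β ^ Q+1         ∎)

    -- With u = xⁿ, both u and β⁻¹ are (Q+1)-th roots of unity, so additivity of x ↦ x^Q gives
    -- β⁻¹ · (H x)^Q · uᵈ = β⁻¹ + uᵈ = H x; dividing by H x leaves β⁻¹ · (H x)ⁿ · uᵈ = 1.
    [Hx]^n*[x^n]^d≈β : ∀ {x} → ¬ x ≈ 0# → ¬ H x ≈ 0# → H x ^ n * (x ^ n) ^ d ≈ β
    [Hx]^n*[x^n]^d≈β {x} x≉0 Hx≉0 = *-cancelˡ-≉0 β⁻¹≉0 (trans β⁻¹*h^n*v≈1 (sym β⁻¹β≈1))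
      where
        h = H x
        v = (x ^ n) ^ d
        v^[Q+1]≈1 : v ^ Q+1 ≈ 1#
        v^[Q+1]≈1 = trans (^-comm (x ^ n) d Q+1) (trans (^-congˡ d ([x^n]^[Q+1]≈1 x≉0)) (1^n≈1 d))
        h^Q*v≈1+β⁻¹^Q*v : h ^ suc n * v ≈ 1# + β⁻¹ ^ suc n * v
        h^Q*v≈1+β⁻¹^Q*v = begin
          h ^ suc n * v                          ≈⟨ *-congʳ (x^Q-additive v β⁻¹) ⟩
          (v ^ suc n + β⁻¹ ^ suc n) * v          ≈⟨ distribʳ _ _ _ ⟩
          v ^ suc n * v + β⁻¹ ^ suc n * v        ≈⟨ +-congʳ (trans (*-comm _ _) (trans (sym (x^[Q+1]≈x*x^Q v)) v^[Q+1]≈1)) ⟩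
          1# + β⁻¹ ^ suc n * v                   ∎
        β⁻¹*h^Q*v≈h : β⁻¹ * (h ^ suc n * v) ≈ h
        β⁻¹*h^Q*v≈h = begin
          β⁻¹ * (h ^ suc n * v)                  ≈⟨ *-congˡ h^Q*v≈1+β⁻¹^Q*v ⟩
          β⁻¹ * (1# + β⁻¹ ^ suc n * v)           ≈⟨ distribˡ _ _ _ ⟩
          β⁻¹ * 1# + β⁻¹ * (β⁻¹ ^ suc n * v)     ≈⟨ +-cong (*-identityʳ _) (sym (*-assoc _ _ _)) ⟩
          β⁻¹ + (β⁻¹ * β⁻¹ ^ suc n) * v          ≈⟨ +-congˡ (*-congʳ (trans (sym (x^[Q+1]≈x*x^Q β⁻¹)) β⁻¹^[Q+1]≈1)) ⟩
          β⁻¹ + 1# * v                           ≈⟨ +-congˡ (*-identityˡ _) ⟩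
          β⁻¹ + v                                ≈⟨ +-comm _ _ ⟩
          h                                      ∎
        β⁻¹*h^n*v≈1 : β⁻¹ * (h ^ n * v) ≈ 1#
        β⁻¹*h^n*v≈1 = *-cancelˡ-≉0 Hx≉0 (begin
          h * (β⁻¹ * (h ^ n * v))  ≈⟨ *-Solver.solve 4 (λ a b c e → a ⊕ (b ⊕ (c ⊕ e)) ⊜ b ⊕ ((a ⊕ c) ⊕ e)) refl h β⁻¹ (h ^ n) v ⟩
          β⁻¹ * (h ^ suc n * v)    ≈⟨ β⁻¹*h^Q*v≈h ⟩
          h                        ≈⟨ *-identityʳ h ⟨
          h * 1#                   ∎)
          where open *-Solver using (_⊕_; _⊜_)

    [fx]^n*[x^n]^d≈β*[x^n]^r : ∀ {x} → ¬ x ≈ 0# → ¬ H x ≈ 0# → f x ^ n * (x ^ n) ^ d ≈ β * (x ^ n) ^ r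
    [fx]^n*[x^n]^d≈β*[x^n]^r {x} x≉0 Hx≉0 = begin
      f x ^ n * (x ^ n) ^ d                  ≈⟨ *-congʳ (^-congˡ n (f≈x^r*H x)) ⟩
      (x ^ r * H x) ^ n * (x ^ n) ^ d        ≈⟨ *-congʳ (^-distrib-* _ _ n) ⟩
      (x ^ r) ^ n * H x ^ n * (x ^ n) ^ d    ≈⟨ *-congʳ (*-congʳ (^-comm x r n)) ⟩
      (x ^ n) ^ r * H x ^ n * (x ^ n) ^ d    ≈⟨ *-assoc _ _ _ ⟩
      (x ^ n) ^ r * (H x ^ n * (x ^ n) ^ d)  ≈⟨ *-congˡ ([Hx]^n*[x^n]^d≈β x≉0 Hx≉0) ⟩
      (x ^ n) ^ r * β                        ≈⟨ *-comm _ _ ⟩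
      β * (x ^ n) ^ r                        ∎

    m : ℕ
    m = ∣ r - d ∣

    -- w zᵈ = β zʳ after cancelling z^min(r,d)
    data Reduced (w z : Carrier) : Set (c ⊔ ℓ) where
      d≤r : d ≤ r → w ≈ β * z ^ m → Reduced w z
      r<d : ¬ d ≤ r → w * z ^ m ≈ β → Reduced w z

    reduce : ∀ {w z} → ¬ z ≈ 0# → w * z ^ d ≈ β * z ^ r → Reduced w z
    reduce {w} {z} z≉0 wz^d≈βz^r with d ℕP.≤? r
    ... | yes d≤r′ = d≤r d≤r′ (*-cancelʳ-≉0 (x≉0⇒x^n≉0 d z≉0) (begin
      w * z ^ d              ≈⟨ wz^d≈βz^r ⟩
      β * z ^ r              ≈⟨ *-congˡ (^-congʳ z d+m≡r) ⟨
      β * z ^ (d ℕ.+ m)      ≈⟨ *-congˡ (^-homo-* z d m) ⟩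
      β * (z ^ d * z ^ m)    ≈⟨ *-Solver.solve 3 (λ a b c → a ⊕ (b ⊕ c) ⊜ (a ⊕ c) ⊕ b) refl β (z ^ d) (z ^ m) ⟩
      β * z ^ m * z ^ d      ∎))
      where
        open *-Solver using (_⊕_; _⊜_)
        d+m≡r : d ℕ.+ m ≡ r
        d+m≡r = ≡.trans (≡.cong (d ℕ.+_) (ℕP.m≤n⇒∣n-m∣≡n∸m d≤r′)) (ℕP.m+[n∸m]≡n d≤r′)
    ... | no d≰r = r<d d≰r (*-cancelʳ-≉0 (x≉0⇒x^n≉0 r z≉0) (begin
      w * z ^ m * z ^ r      ≈⟨ *-Solver.solve 3 (λ a b c → (a ⊕ b) ⊕ c ⊜ a ⊕ (c ⊕ b)) refl w (z ^ m) (z ^ r) ⟩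
      w * (z ^ r * z ^ m)    ≈⟨ *-congˡ (^-homo-* z r m) ⟨
      w * z ^ (r ℕ.+ m)      ≈⟨ *-congˡ (^-congʳ z r+m≡d) ⟩
      w * z ^ d              ≈⟨ wz^d≈βz^r ⟩
      β * z ^ r              ∎))
      where
        open *-Solver using (_⊕_; _⊜_)
        r≤d : r ≤ d
        r≤d = ℕP.<⇒≤ (ℕP.≰⇒> d≰r)
        r+m≡d : r ℕ.+ m ≡ d
        r+m≡d = ≡.trans (≡.cong (r ℕ.+_) (≡.trans (ℕP.∣-∣-comm r d) (ℕP.m≤n⇒∣n-m∣≡n∸m r≤d))) (ℕP.m+[n∸m]≡n r≤d)

    e : ℕ
    e = expo (suc n) d

    g : ℕ
    g = gcd (suc (suc n)) d

    e*g≡2+n : e ℕ.* g ≡ suc (suc n)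
    e*g≡2+n = m/n*n≡m {{≢-nonZero (gcd[m,n]≢0 (suc (suc n)) d (inj₁ λ ()))}} (gcd[m,n]∣m (suc (suc n)) d)

    [2+n]∣d*e : suc (suc n) ∣ d ℕ.* e
    [2+n]∣d*e with gcd[m,n]∣n (suc (suc n)) d
    ... | divides k d≡k*g = divides k (≡.trans (≡.cong (ℕ._* e) d≡k*g)
                                        (≡.trans (ℕP.*-assoc k g e) (≡.cong (k ℕ.*_) (≡.trans (ℕP.*-comm g e) e*g≡2+n))))

    [-β]^e*[-β⁻¹]^e≈1 : (- β) ^ e * (- β⁻¹) ^ e ≈ 1#
    [-β]^e*[-β⁻¹]^e≈1 = begin
      (- β) ^ e * (- β⁻¹) ^ e  ≈⟨ ^-distrib-* _ _ e ⟨
      (- β * - β⁻¹) ^ e        ≈⟨ ^-congˡ e (trans (-x*-y≈x*y β β⁻¹) (trans (*-comm β β⁻¹) β⁻¹β≈1)) ⟩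
      1# ^ e                   ≈⟨ 1^n≈1 e ⟩
      1#                       ∎

    -- H x = 0 means uᵈ = -β⁻¹ for u = xⁿ, and then (-β⁻¹)^e = u^(de) = 1 as Q + 1 divides de.
    -β^e≉1⇒H≉0 : ¬ (- β) ^ e ≈ 1# → ∀ {x} → ¬ x ≈ 0# → ¬ H x ≈ 0#
    -β^e≉1⇒H≉0 -β^e≉1 {x} x≉0 Hx≈0 =
      -β^e≉1 (trans (sym (*-identityʳ _)) (trans (*-congˡ (sym [-β⁻¹]^e≈1)) [-β]^e*[-β⁻¹]^e≈1))
      where
        u = x ^ n
        u^d≈-β⁻¹ : u ^ d ≈ - β⁻¹
        u^d≈-β⁻¹ = +-inverseˡ-unique (u ^ d) β⁻¹ Hx≈0
        [-β⁻¹]^e≈1 : (- β⁻¹) ^ e ≈ 1#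
        [-β⁻¹]^e≈1 = begin
          (- β⁻¹) ^ e      ≈⟨ ^-congˡ e u^d≈-β⁻¹ ⟨
          (u ^ d) ^ e      ≈⟨ ^-assocʳ u d e ⟩
          u ^ (d ℕ.* e)    ≈⟨ x^m≈1∧m∣k⇒x^k≈1 (suc (suc n)) (trans (^-congʳ u (≡.sym Q+1≡2+n)) ([x^n]^[Q+1]≈1 x≉0)) [2+n]∣d*e ⟩
          1#               ∎

    1≤e : 1 ≤ e
    1≤e = ℕP.n≢0⇒n>0 (λ e≡0 → ℕP.0≢1+n (≡.trans (≡.sym (≡.cong (ℕ._* g) e≡0)) e*g≡2+n))

    n*g*e≡N : n ℕ.* g ℕ.* e ≡ n ℕ.* Q+1
    n*g*e≡N = ≡.trans (ℕP.*-assoc n g e) (≡.cong (n ℕ.*_) (≡.trans (ℕP.*-comm g e) (≡.trans e*g≡2+n (≡.sym Q+1≡2+n))))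

    -- With γ = -β⁻¹ = w^(ng) and t = wⁿ, a Bézout combination t^g = (tᵈ)ᵏ of tᵈ and t^(Q+1) = 1 gives (Xⁿ)ᵈ = γ for X = wᵏ.
    -β^e≈1⇒∃H≈0 : (- β) ^ e ≈ 1# → ∃ λ X → ¬ X ≈ 0# × H X ≈ 0#
    -β^e≈1⇒∃H≈0 -β^e≈1 = from-root (∃x^D≈c (n ℕ.* g) e (ℕP.*-mono-≤ 1≤n 1≤g) 1≤e n*g*e≡N γ^e≈1)
      where
        γ = - β⁻¹
        1≤g : 1 ≤ g
        1≤g = ℕP.n≢0⇒n>0 (gcd[m,n]≢0 (suc (suc n)) d (inj₁ λ ()))
        γ^e≈1 : γ ^ e ≈ 1#
        γ^e≈1 = trans (sym (*-identityˡ _)) (trans (*-congʳ (sym -β^e≈1)) [-β]^e*[-β⁻¹]^e≈1)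
        γ≉0 : ¬ γ ≈ 0#
        γ≉0 = x^n≈1⇒x≉0 e 1≤e γ^e≈1
        from-root : (∃ λ w → w ^ (n ℕ.* g) ≈ γ) → ∃ λ X → ¬ X ≈ 0# × H X ≈ 0#
        from-root (w , w^[ng]≈γ) = from-bézout (∃[x^m]^k≈x^gcd[m,n] {t} d (s≤s z≤n) t^[Q+1]≈1)
          where
            t = w ^ n
            t^g≈γ : t ^ g ≈ γ
            t^g≈γ = trans (^-assocʳ w n g) w^[ng]≈γ
            w≉0 : ¬ w ≈ 0#
            w≉0 w≈0 = γ≉0 (trans (sym w^[ng]≈γ) (trans (^-congˡ (n ℕ.* g) w≈0) (0^n≈0 (n ℕ.* g) (ℕP.*-mono-≤ 1≤n 1≤g))))
            t^[Q+1]≈1 : t ^ Q+1 ≈ 1#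
            t^[Q+1]≈1 = [x^n]^[Q+1]≈1 w≉0
            from-bézout : (∃ λ k → (t ^ d) ^ k ≈ t ^ gcd d Q+1) → ∃ λ X → ¬ X ≈ 0# × H X ≈ 0#
            from-bézout (k , [t^d]^k≈t^gcd) = w ^ k , X≉0 , trans (+-congʳ [X^n]^d≈γ) (-‿inverseˡ β⁻¹)
              where
                [X^n]^d≈γ : ((w ^ k) ^ n) ^ d ≈ γ
                [X^n]^d≈γ = begin
                  ((w ^ k) ^ n) ^ d  ≈⟨ ^-congˡ d (^-comm w k n) ⟩
                  (t ^ k) ^ d        ≈⟨ ^-comm t k d ⟩
                  (t ^ d) ^ k        ≈⟨ [t^d]^k≈t^gcd ⟩
                  t ^ gcd d Q+1      ≈⟨ ^-congʳ t (≡.trans (gcd-comm d Q+1) (≡.cong (λ q → gcd q d) Q+1≡2+n)) ⟩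
                  t ^ g              ≈⟨ t^g≈γ ⟩
                  γ                  ∎
                X≉0 : ¬ w ^ k ≈ 0#
                X≉0 = x≉0⇒x^n≉0 k w≉0

    fx≉0⇒x≉0 : ∀ {x} → ¬ f x ≈ 0# → ¬ x ≈ 0#
    fx≉0⇒x≉0 fx≉0 x≈0 = fx≉0 (trans (f-cong x≈0) f0≈0)

    [fx]^n≈βω⇒ω≈[x^n]^±m : ∀ {x ω} → ¬ f x ≈ 0# → f x ^ n ≈ β * ω → ω ≈ (x ^ n) ^ m ⊎ ω * (x ^ n) ^ m ≈ 1#
    [fx]^n≈βω⇒ω≈[x^n]^±m {x} {ω} fx≉0 [fx]^n≈βω = unreduce (reduce (x≉0⇒x^n≉0 n x≉0) βω*u^d≈β*u^r)
      where
        x≉0 : ¬ x ≈ 0#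
        x≉0 = fx≉0⇒x≉0 fx≉0
        Hx≉0 : ¬ H x ≈ 0#
        Hx≉0 Hx≈0 = fx≉0 (trans (f≈x^r*H x) (trans (*-congˡ Hx≈0) (zeroʳ _)))
        βω*u^d≈β*u^r : (β * ω) * (x ^ n) ^ d ≈ β * (x ^ n) ^ r
        βω*u^d≈β*u^r = trans (*-congʳ (sym [fx]^n≈βω)) ([fx]^n*[x^n]^d≈β*[x^n]^r x≉0 Hx≉0)
        unreduce : ∀ {u} → Reduced (β * ω) u → ω ≈ u ^ m ⊎ ω * u ^ m ≈ 1#
        unreduce (d≤r _ βω≈βu^m) = inj₁ (*-cancelˡ-≉0 β≉0 βω≈βu^m)
        unreduce (r<d _ βωu^m≈β) = inj₂ (*-cancelˡ-≉0 β≉0 (trans (sym (*-assoc β ω _)) (trans βωu^m≈β (sym (*-identityʳ β)))))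

    u^[Q+1]≈1∧ω≈u^±m⇒ω^k≈1 : ∀ {k u ω} → Q+1 ∣ m ℕ.* k → u ^ Q+1 ≈ 1# → ω ≈ u ^ m ⊎ ω * u ^ m ≈ 1# → ω ^ k ≈ 1#
    u^[Q+1]≈1∧ω≈u^±m⇒ω^k≈1 {k} {u} {ω} Q+1∣m*k u^[Q+1]≈1 = ω^k≈1
      where
        [u^m]^k≈1 : (u ^ m) ^ k ≈ 1#
        [u^m]^k≈1 = trans (^-assocʳ u m k) (x^m≈1∧m∣k⇒x^k≈1 Q+1 u^[Q+1]≈1 Q+1∣m*k)
        ω^k≈1 : ω ≈ u ^ m ⊎ ω * u ^ m ≈ 1# → ω ^ k ≈ 1#
        ω^k≈1 (inj₁ ω≈u^m) = trans (^-congˡ k ω≈u^m) [u^m]^k≈1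
        ω^k≈1 (inj₂ ωu^m≈1) = begin
          ω ^ k                  ≈⟨ *-identityʳ _ ⟨
          ω ^ k * 1#             ≈⟨ *-congˡ [u^m]^k≈1 ⟨
          ω ^ k * (u ^ m) ^ k    ≈⟨ ^-distrib-* ω (u ^ m) k ⟨
          (ω * u ^ m) ^ k        ≈⟨ ^-congˡ k ωu^m≈1 ⟩
          1# ^ k                 ≈⟨ 1^n≈1 k ⟩
          1#                     ∎

    module _ (gcd[r,n]≡1 : gcd r n ≡ 1) (gcd[m,Q+1]≡1 : gcd m Q+1 ≡ 1) (-β^e≉1 : ¬ (- β) ^ e ≈ 1#) where

      H≉0 : ∀ {x} → ¬ x ≈ 0# → ¬ H x ≈ 0#
      H≉0 = -β^e≉1⇒H≉0 -β^e≉1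

      -- Both xⁿ and yⁿ satisfy the reduced form of f x ^ n · wᵈ = β wʳ, which determines w^m.
      fx≈fy⇒[x^n]^m≈[y^n]^m : ∀ {x y} → ¬ x ≈ 0# → ¬ y ≈ 0# → f x ≈ f y → (x ^ n) ^ m ≈ (y ^ n) ^ m
      fx≈fy⇒[x^n]^m≈[y^n]^m {x} {y} x≉0 y≉0 fx≈fy = compare
        (reduce (x≉0⇒x^n≉0 n x≉0) ([fx]^n*[x^n]^d≈β*[x^n]^r x≉0 (H≉0 x≉0)))
        (reduce (x≉0⇒x^n≉0 n y≉0) (trans (*-congʳ (^-congˡ n fx≈fy)) ([fx]^n*[x^n]^d≈β*[x^n]^r y≉0 (H≉0 y≉0))))
        where
          compare : ∀ {u v} → Reduced (f x ^ n) u → Reduced (f x ^ n) v → u ^ m ≈ v ^ m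
          compare (d≤r _ a) (d≤r _ b) = *-cancelˡ-≉0 β≉0 (trans (sym a) b)
          compare (d≤r p _) (r<d q _) = ⊥-elim (q p)
          compare (r<d q _) (d≤r p _) = ⊥-elim (q p)
          compare (r<d _ a) (r<d _ b) = *-cancelˡ-≉0 (x≉0⇒x^n≉0 n (f≉0 x≉0 (H≉0 x≉0))) (trans a (sym b))

      f-injective : Injective _≈_ _≈_ f
      f-injective {x} {y} fx≈fy with x ≈? 0# | y ≈? 0#
      ... | yes x≈0 | yes y≈0 = trans x≈0 (sym y≈0)
      ... | yes x≈0 | no y≉0 = ⊥-elim (f≉0 y≉0 (H≉0 y≉0) (trans (sym fx≈fy) (trans (f-cong x≈0) f0≈0)))
      ... | no x≉0 | yes y≈0 = ⊥-elim (f≉0 x≉0 (H≉0 x≉0) (trans fx≈fy (trans (f-cong y≈0) f0≈0)))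
      ... | no x≉0 | no y≉0 = coprime-powers⇒≈ r n 1≤n gcd[r,n]≡1 x^r≈y^r x^n≈y^n y≉0
        where
          x^n≈y^n : x ^ n ≈ y ^ n
          x^n≈y^n = coprime-powers⇒≈ m Q+1 (s≤s z≤n) gcd[m,Q+1]≡1 (fx≈fy⇒[x^n]^m≈[y^n]^m x≉0 y≉0 fx≈fy)
                      (trans ([x^n]^[Q+1]≈1 x≉0) (sym ([x^n]^[Q+1]≈1 y≉0))) (x≉0⇒x^n≉0 n y≉0)
          x^r≈y^r : x ^ r ≈ y ^ r
          x^r≈y^r = *-cancelʳ-≉0 (H≉0 x≉0)
            (trans (sym (f≈x^r*H x)) (trans fx≈fy (trans (f≈x^r*H y) (*-congˡ (+-congʳ (^-congˡ d (sym x^n≈y^n)))))))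

      conditions⇒permutes : Permutes F f
      conditions⇒permutes = injective⇒bijective f-cong f-injective

    module _ (f-permutes : Permutes F f) where

      f-inj : Injective _≈_ _≈_ f
      f-inj = proj₁ f-permutes

      f-surj : ∀ y → ∃ λ x → f x ≈ y
      f-surj y = proj₁ (proj₂ f-permutes y) , proj₂ (proj₂ f-permutes y) refl

      f≈1+β⁻¹ : ∀ {z} → z ^ r ≈ 1# → z ^ n ≈ 1# → f z ≈ 1# + β⁻¹
      f≈1+β⁻¹ {z} z^r≈1 z^n≈1 =
        trans (f≈x^r*H z) (trans (*-cong z^r≈1 (+-congʳ (trans (^-congˡ d z^n≈1) (1^n≈1 d)))) (*-identityˡ _))

      -- A nontrivial l-th root of unity ω is fixed by x ↦ xʳ and x ↦ xⁿ, so f ω = f 1.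
      no-common-factor-r-n : ∀ {l} → l ∣ r → l ∣ n → 2 ≤ l → ⊥
      no-common-factor-r-n {l} l∣r l∣n 2≤l =
        let ω , ω^l≈1 , ω^1≉1 = ∃ω^g≈1∧ω^e≉1 (quotient l∣n ℕ.* Q+1) (quotient*k*l≡n*k l∣n Q+1) (s≤s z≤n) 2≤l
            ω^r≈1 = x^m≈1∧m∣k⇒x^k≈1 l ω^l≈1 l∣r
            ω^n≈1 = x^m≈1∧m∣k⇒x^k≈1 l ω^l≈1 l∣n
        in ω^1≉1 (trans (*-identityʳ ω) (f-inj (trans (f≈1+β⁻¹ ω^r≈1 ω^n≈1) (sym (f≈1+β⁻¹ (1^n≈1 r) (1^n≈1 n))))))

      -- For an n-th root t of βω, a preimage x₀ of t has f x₀ ^ n = βω.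
      ω^[Q+1]≈1⇒ω≈u^±m : ∀ {ω} → ω ^ Q+1 ≈ 1# → ∃ λ u → u ^ Q+1 ≈ 1# × (ω ≈ u ^ m ⊎ ω * u ^ m ≈ 1#)
      ω^[Q+1]≈1⇒ω≈u^±m {ω} ω^[Q+1]≈1 =
        let t , t^n≈βω = ∃x^D≈c n Q+1 1≤n (s≤s z≤n) ≡.refl βω^[Q+1]≈1
            x₀ , fx₀≈t = f-surj t
            fx₀≉0 : ¬ f x₀ ≈ 0#
            fx₀≉0 fx₀≈0 = x^n≈1⇒x≉0 Q+1 (s≤s z≤n) βω^[Q+1]≈1
                            (trans (sym t^n≈βω) (trans (^-congˡ n (trans (sym fx₀≈t) fx₀≈0)) (0^n≈0 n 1≤n)))
        in x₀ ^ n , [x^n]^[Q+1]≈1 (fx≉0⇒x≉0 fx₀≉0) , [fx]^n≈βω⇒ω≈[x^n]^±m fx₀≉0 (trans (^-congˡ n fx₀≈t) t^n≈βω)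
        where
          βω^[Q+1]≈1 : (β * ω) ^ Q+1 ≈ 1#
          βω^[Q+1]≈1 = trans (^-distrib-* β ω Q+1) (trans (*-cong β^[Q+1]≈1 ω^[Q+1]≈1) (*-identityˡ _))

      -- With Q + 1 = l e′, a (Q+1)-th root of unity ω with ω^e′ ≠ 1 cannot be u^±m, as (u^m)^e′ = 1.
      no-common-factor-m-[Q+1] : ∀ {l} → l ∣ m → l ∣ Q+1 → 2 ≤ l → ⊥
      no-common-factor-m-[Q+1] {l} l∣m l∣Q+1 2≤l =
        let 1≤e′ , e′<Q+1 = proper-factor e′ (≡.sym (m∣n⇒n≡quotient*m l∣Q+1)) (s≤s z≤n) 2≤l
            ω , ω^[Q+1]≈1 , ω^e′≉1 = ∃ω^g≈1∧ω^e≉1 n {Q+1} {e′} ≡.refl 1≤e′ e′<Q+1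
            u , u^[Q+1]≈1 , ω≈u^±m = ω^[Q+1]≈1⇒ω≈u^±m ω^[Q+1]≈1
        in ω^e′≉1 (u^[Q+1]≈1∧ω≈u^±m⇒ω^k≈1 {e′} {u} {ω} Q+1∣m*e′ u^[Q+1]≈1 ω≈u^±m)
        where
          e′ = quotient l∣Q+1
          Q+1∣m*e′ : Q+1 ∣ m ℕ.* e′
          Q+1∣m*e′ = ≡.subst (_∣ m ℕ.* e′) (≡.sym (m∣n⇒n≡m*quotient l∣Q+1)) (*-monoˡ-∣ e′ l∣m)

      permutes⇒-β^e≉1 : ¬ (- β) ^ e ≈ 1#
      permutes⇒-β^e≉1 -β^e≈1 =
        let X , X≉0 , HX≈0 = -β^e≈1⇒∃H≈0 -β^e≈1
        in X≉0 (f-inj (trans (f≈x^r*H X) (trans (*-congˡ HX≈0) (trans (zeroʳ _) (sym f0≈0)))))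

      permutes⇒conditions : gcd r n ≡ 1 × gcd m Q+1 ≡ 1 × ¬ (- β) ^ e ≈ 1#
      permutes⇒conditions =
        no-common-factor⇒gcd≡1 r n (inj₁ (ℕP.n>0⇒n≢0 1≤r)) no-common-factor-r-n ,
        no-common-factor⇒gcd≡1 m Q+1 (inj₂ λ ()) no-common-factor-m-[Q+1] ,
        permutes⇒-β^e≉1

    permutes⇔conditions : Permutes F f ⇔ (gcd r n ≡ 1 × gcd m Q+1 ≡ 1 × ¬ (- β) ^ e ≈ 1#)
    permutes⇔conditions = mk⇔ permutes⇒conditions (λ (c₁ , c₂ , c₃) → conditions⇒permutes c₁ c₂ c₃)

open import Data.Nat using (_+_; _*_; _^_)

corollary5p2 : ∀ {c ℓ} (Q : ℕ) → IsPrimePower Q →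
    (F : CommutativeRing c ℓ) → IsField F → HasCard F (Q ^ 2) →
    (r d : ℕ) → 1 ≤ r → 1 ≤ d →
    (β βinv : CommutativeRing.Carrier F) →
    CommutativeRing._≈_ F (pow F β (Q + 1)) (CommutativeRing.1# F) →
    CommutativeRing._≈_ F (CommutativeRing._*_ F βinv β) (CommutativeRing.1# F) →
    Permutes F (λ x → CommutativeRing._+_ F (pow F x (r + d * (Q ∸ 1))) (CommutativeRing._*_ F βinv (pow F x r)))
    ⇔ (gcd r (Q ∸ 1) ≡ 1 × gcd ∣ r - d ∣ (Q + 1) ≡ 1
       × ¬ CommutativeRing._≈_ F (pow F (CommutativeRing.-_ F β) (expo Q d)) (CommutativeRing.1# F))
corollary5p2 Q Q-prime-power@(p , k , p-prime , _ , Q≡p^k) F isField card r d 1≤r 1≤d β β⁻¹ β^[Q+1]≈1 β⁻¹β≈1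
  with prime-power≥2 Q-prime-power
... | s≤s {n = n} 1≤n =
  permutes⇔conditions 1≤n (x^Q-additive⇐Q≡p^k {p} {k} p-prime Q≡p^k) r d 1≤r 1≤d β β⁻¹ β^[Q+1]≈1 β⁻¹β≈1
  where open PermutationCriterion F isField n (≡.subst (HasCard F) ([1+n]^2≡1+n*[[1+n]+1] n) card)
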